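{- Let $A$ and $B$ be finite alphabets and let $g,h\colon A^*\to B^*$ be morphisms. Then the instance $(g,h)$ has a solution to the $(1,2)$-permutational PCP if and only if it has a solution to the $(2,2)$-permutational PCP.
   Context: For words $u,v$ and a positive integer $m$, write $u\sim_m v$ if there exist words $u_1,\dots,u_m$ and a permutation $\tau$ of $\{1,\dots,m\}$ such that $u=u_1\cdots u_m$ and $v=u_{\tau(1)}\cdots u_{\tau(m)}$. For morphisms $g,h\colon A^*\to B^*$, a solution of the instance $(g,h)$ of the $(m,n)$-permutational PCP is a pair of words $u,v\in A^*$ such that $u\sim_m v$ and $g(u)\sim_n h(v)$. -}

module Defs where

open import Data.Nat using (ℕ)
open import Data.Fin using (Fin)
open import Data.Fin.Permutation using (Permutation′; _⟨$⟩ʳ_)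
open import Data.List using (List; []; concatMap; _++_)
open import Data.Vec.Functional using (Vector; foldr)
open import Data.Product using (Σ; ∃; _×_)
open import Relation.Binary.PropositionalEquality using (_≡_; _≢_)

concatW : ∀ {X : Set} {m : ℕ} → Vector (List X) m → List X
concatW us = foldr _++_ [] us

_∼[_]_ : {X : Set} → List X → ℕ → List X → Set
u ∼[ m ] v = Σ (Vector _ m) λ us → Σ (Permutation′ m) λ τ →
  (u ≡ concatW us) × (v ≡ concatW (λ i → us (τ ⟨$⟩ʳ i)))

-- a morphism A* → B* with A = Fin a, B = Fin b, given by letter images
Morphism : ℕ → ℕ → Set
Morphism a b = Fin a → List (Fin b)

apply : ∀ {a b} → Morphism a b → List (Fin a) → List (Fin b)
apply g = concatMap g

HasSolution : ℕ → ℕ → ∀ {a b} → Morphism a b → Morphism a b → Set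
HasSolution m n {a} g h = Σ (List (Fin a)) λ u → Σ (List (Fin a)) λ v →
  (u ≢ []) × (u ∼[ m ] v) × (apply g u ∼[ n ] apply h v)

{-# OPTIONS --safe #-}
-- Two words are related by ∼₂ exactly when they are conjugate (u = pq, v = qp), and
-- conjugacy is an equivalence relation preserved by morphisms. Hence if u ∼₂ v and
-- g(u) ∼₂ h(v), then h(u) ∼₂ h(v) and so g(u) ∼₂ h(u): the pair (u, u) solves the
-- (1,2)-problem. Conversely ∼₁ is equality, which is contained in ∼₂.
module Submission where

open import Defs
open import Data.Nat using (ℕ)
open import Data.Fin using (Fin; zero; suc)
open import Data.Fin.Permutation using (Permutation′; _⟨$⟩ʳ_; _⟨$⟩ˡ_; inverseˡ; id; transpose)
open import Data.List using (List; []; _∷_; _++_)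
open import Data.List.Properties using (++-assoc; ++-identityʳ; ∷-injective; concatMap-++)
open import Data.Product using (Σ; _×_; _,_)
open import Data.Sum using (_⊎_; inj₁; inj₂)
open import Data.Empty using (⊥-elim)
open import Relation.Binary.PropositionalEquality
  using (_≡_; _≢_; refl; sym; trans; cong; subst)

⟨$⟩ʳ-injective : ∀ {n} (τ : Permutation′ n) {i j} → τ ⟨$⟩ʳ i ≡ τ ⟨$⟩ʳ j → i ≡ j
⟨$⟩ʳ-injective τ e = trans (sym (inverseˡ τ)) (trans (cong (τ ⟨$⟩ˡ_) e) (inverseˡ τ))

0≢1 : zero {1} ≢ suc zero
0≢1 ()

module _ {X : Set} where

  ++-levi : (xs ys zs ws : List X) → xs ++ ys ≡ zs ++ ws →
    (Σ (List X) λ r → (zs ≡ xs ++ r) × (ys ≡ r ++ ws)) ⊎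
    (Σ (List X) λ r → (xs ≡ zs ++ r) × (ws ≡ r ++ ys))
  ++-levi []       ys zs       ws e = inj₁ (zs , refl , e)
  ++-levi (x ∷ xs) ys []       ws e = inj₂ (x ∷ xs , refl , sym e)
  ++-levi (x ∷ xs) ys (z ∷ zs) ws e with ∷-injective e
  ... | refl , e′ with ++-levi xs ys zs ws e′
  ...   | inj₁ (r , p , q) = inj₁ (r , cong (x ∷_) p , q)
  ...   | inj₂ (r , p , q) = inj₂ (r , cong (x ∷_) p , q)

  Conjugate : List X → List X → Set
  Conjugate u v = Σ (List X) λ p → Σ (List X) λ q → (u ≡ p ++ q) × (v ≡ q ++ p)

  conjugate-refl : ∀ {u} → Conjugate u u
  conjugate-refl {u} = u , [] , sym (++-identityʳ u) , refl

  conjugate-sym : ∀ {u v} → Conjugate u v → Conjugate v u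
  conjugate-sym (p , q , u≡pq , v≡qp) = q , p , v≡qp , u≡pq

  -- Levi's lemma on qp = rs aligns the two factorisations of the middle word.
  conjugate-trans : ∀ {u v w} → Conjugate u v → Conjugate v w → Conjugate u w
  conjugate-trans (p , q , refl , refl) (r , s , qp≡rs , refl) with ++-levi q p r s qp≡rs
  ... | inj₁ (t , refl , refl) = t , s ++ q , ++-assoc t s q , sym (++-assoc s q t)
  ... | inj₂ (t , refl , refl) = p ++ r , t , sym (++-assoc p r t) , ++-assoc t p r

  concatW₂ : (us : Fin 2 → List X) → concatW us ≡ us zero ++ us (suc zero)
  concatW₂ us = cong (us zero ++_) (++-identityʳ (us (suc zero)))

  ∼[1]⇒≡ : ∀ {u v : List X} → u ∼[ 1 ] v → u ≡ v
  ∼[1]⇒≡ (us , τ , u≡ , v≡) with τ ⟨$⟩ʳ zero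
  ... | zero = trans u≡ (sym v≡)

  ∼[1]-refl : ∀ {u : List X} → u ∼[ 1 ] u
  ∼[1]-refl {u} = (λ _ → u) , id , sym (++-identityʳ u) , sym (++-identityʳ u)

  ∼[2]⇒conjugate : ∀ {u v : List X} → u ∼[ 2 ] v → Conjugate u v
  ∼[2]⇒conjugate {u} (us , τ , u≡ , v≡) with τ ⟨$⟩ʳ zero in τ0 | τ ⟨$⟩ʳ suc zero in τ1
  ... | zero     | suc zero = subst (Conjugate u) (trans u≡ (sym v≡)) conjugate-refl
  ... | suc zero | zero     =
    us zero , us (suc zero) , trans u≡ (concatW₂ us) ,
    trans v≡ (cong (us (suc zero) ++_) (++-identityʳ (us zero)))
  ... | zero     | zero     = ⊥-elim (0≢1 (⟨$⟩ʳ-injective τ (trans τ0 (sym τ1))))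
  ... | suc zero | suc zero = ⊥-elim (0≢1 (⟨$⟩ʳ-injective τ (trans τ0 (sym τ1))))

  conjugate⇒∼[2] : ∀ {u v : List X} → Conjugate u v → u ∼[ 2 ] v
  conjugate⇒∼[2] (p , q , u≡pq , v≡qp) = pq , transpose zero (suc zero) ,
      trans u≡pq (sym (concatW₂ pq)) , trans v≡qp (sym (concatW₂ qp))
    where pq : Fin 2 → List X
          pq zero = p
          pq (suc zero) = q
          qp : Fin 2 → List X
          qp zero = q
          qp (suc zero) = p

apply-conjugate : ∀ {a b} (g : Morphism a b) {u v} → Conjugate u v → Conjugate (apply g u) (apply g v)
apply-conjugate g (p , q , refl , refl) =
  apply g p , apply g q , concatMap-++ g p q , concatMap-++ g q p

lemma1 : (a b : ℕ) (g h : Morphism a b) →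
    (HasSolution 1 2 g h → HasSolution 2 2 g h) × (HasSolution 2 2 g h → HasSolution 1 2 g h)
lemma1 a b g h = one⇒two , two⇒one
  where
  one⇒two : HasSolution 1 2 g h → HasSolution 2 2 g h
  one⇒two (u , v , u≢[] , u∼₁v , gu∼₂hv) with refl ← ∼[1]⇒≡ u∼₁v =
    u , u , u≢[] , conjugate⇒∼[2] conjugate-refl , gu∼₂hv

  two⇒one : HasSolution 2 2 g h → HasSolution 1 2 g h
  two⇒one (u , v , u≢[] , u∼₂v , gu∼₂hv) =
    u , u , u≢[] , ∼[1]-refl , conjugate⇒∼[2] (conjugate-trans gu∼hv (conjugate-sym hu∼hv))
    where
    gu∼hv : Conjugate (apply g u) (apply h v)
    gu∼hv = ∼[2]⇒conjugate gu∼₂hv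
    hu∼hv : Conjugate (apply h u) (apply h v)
    hu∼hv = apply-conjugate h (∼[2]⇒conjugate u∼₂v)
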